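{- Let $H$ be a graph of diameter 2 and let $G$ be a graph such that $G\,\Box\,H$ has an EOD-set $D$. Then for every vertex $g$ of $G$, $|D\cap {}^{g}H|\le 2$. If in addition $D$ is parallel with respect to $G$, then $|D\cap {}^{g}H|\le 1$ for every $g\in V(G)$. If $|D\cap {}^{g}H|=2$, then the two distinct vertices of $D\cap {}^{g}H$ are adjacent.
   Context: All graphs are finite and simple. An EOD-set of a graph $X$ is a set $D\subseteq V(X)$ with $\bigcup_{v\in D}N(v)=V(X)$ and $N(u)\cap N(v)=\emptyset$ for all distinct $u,v\in D$ ($N$ = open neighborhood). In the Cartesian product $G\,\Box\,H$, vertices $(g,h),(g',h')$ are adjacent iff ($gg'\in E(G)$ and $h=h'$) or ($g=g'$ and $hh'\in E(H)$). For $g\in V(G)$, the $H$-layer is ${}^{g}H=\{(g,h): h\in V(H)\}$. An EOD-set $D$ of $G\,\Box\,H$ is parallel with respect to $G$ if for every edge of the subgraph induced by $D$, its two end vertices have distinct $G$-coordinates (i.e. its projection onto $G$ is an edge, not a single vertex). -}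

module Defs where

open import Data.Nat using (ℕ; zero; suc; _+_)
open import Data.Fin using (Fin)
open import Data.Bool using (Bool; true; false)
open import Data.List using (List; []; _∷_; map; allFin)
open import Data.Product using (_×_; _,_; proj₁; proj₂; ∃-syntax)
open import Relation.Binary.PropositionalEquality using (_≡_; _≢_)
open import Relation.Nullary using (¬_)
open import Data.Sum using (_⊎_)

record Graph : Set where
  field
    n     : ℕ
    adj   : Fin n → Fin n → Bool
    sym   : ∀ u v → adj u v ≡ adj v u
    irrefl : ∀ v → adj v v ≡ false

open Graph public

Vtx : Graph → Set
Vtx G = Fin (n G)

Adj : (G : Graph) → Vtx G → Vtx G → Set
Adj G u v = adj G u v ≡ true

Dist≤2 : (G : Graph) → Vtx G → Vtx G → Set
Dist≤2 G u v = (u ≡ v) ⊎ (Adj G u v ⊎ (∃[ w ] (Adj G u w × Adj G w v)))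

Dist≡2 : (G : Graph) → Vtx G → Vtx G → Set
Dist≡2 G u v = u ≢ v × ¬ Adj G u v × (∃[ w ] (Adj G u w × Adj G w v))

Diameter2 : Graph → Set
Diameter2 G = (∀ u v → Dist≤2 G u v) × (∃[ u ] ∃[ v ] Dist≡2 G u v)

PVtx : Graph → Graph → Set
PVtx G H = Vtx G × Vtx H

AdjBox : (G H : Graph) → PVtx G H → PVtx G H → Set
AdjBox G H (g , h) (g' , h') =
  (Adj G g g' × h ≡ h') ⊎ (g ≡ g' × Adj H h h')

IsEOD : (V : Set) (A : V → V → Set) (D : V → Bool) → Set
IsEOD V A D =
  (∀ x → ∃[ v ] (D v ≡ true × A v x)) ×
  (∀ u v → D u ≡ true → D v ≡ true → u ≢ v → ∀ x → ¬ (A u x × A v x))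

ParallelG : (G H : Graph) (D : PVtx G H → Bool) → Set
ParallelG G H D = ∀ x y → D x ≡ true → D y ≡ true → AdjBox G H x y →
  proj₁ x ≢ proj₁ y

countTrue : List Bool → ℕ
countTrue [] = 0
countTrue (true ∷ bs) = suc (countTrue bs)
countTrue (false ∷ bs) = countTrue bs

layerCount : (G H : Graph) (D : PVtx G H → Bool) → Vtx G → ℕ
layerCount G H D g = countTrue (map (λ h → D (g , h)) (allFin (n H)))

module Submission where

-- Two distinct
-- members (g , h), (g , h') of D in the layer ᵍH lie in H at distance at
-- most 2.  Distance 2 is impossible: a common H-neighbour w of h and h'
-- gives a common neighbour (g , w) of both members, contradicting the
-- disjointness of open neighbourhoods in D.  Hence distinct members of D
-- in one layer are adjacent (third claim).  Three distinct members would
-- then be pairwise adjacent, so the third one is a common neighbour of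
-- the first two -- again impossible; hence |D ∩ ᵍH| ≤ 2 (first claim).
-- If D is parallel, two members in one layer cannot be adjacent at all,
-- so there is at most one (second claim).

open import Defs
open import Data.Nat using (ℕ; zero; suc; _≤_; z≤n; s≤s)
open import Data.Bool using (Bool; true; false)
open import Data.Product using (_×_; _,_; proj₂)
open import Data.Sum using (inj₁; inj₂)
open import Data.Fin using (Fin; _≟_) renaming (zero to fzero; suc to fsuc)
open import Data.Fin.Properties using (suc-injective; 0≢1+n)
open import Data.List using (tabulate)
open import Data.List.Properties using (map-tabulate)
open import Data.Empty using (⊥; ⊥-elim)
open import Relation.Nullary using (¬_; yes; no)
open import Function using (id; _∘_)
open import Relation.Binary.PropositionalEquality
  using (_≡_; _≢_; refl; cong; trans)

countFin : (m : ℕ) → (Fin m → Bool) → ℕ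
countFin m f = countTrue (tabulate f)

layerCount≡countFin : ∀ G H D g →
  layerCount G H D g ≡ countFin (n H) (λ h → D (g , h))
layerCount≡countFin G H D g = cong countTrue (map-tabulate id (λ h → D (g , h)))

AtMostOne : ∀ {m} → (Fin m → Bool) → Set
AtMostOne f = ∀ i j → f i ≡ true → f j ≡ true → i ≡ j

NoThreeDistinct : ∀ {m} → (Fin m → Bool) → Set
NoThreeDistinct f = ∀ i j k → i ≢ j → i ≢ k → j ≢ k →
  f i ≡ true → f j ≡ true → f k ≡ true → ⊥

countFin-none : ∀ m (f : Fin m → Bool) → (∀ i → f i ≢ true) → countFin m f ≡ 0
countFin-none zero    f none = refl
countFin-none (suc m) f none with f fzero in e
... | true  = ⊥-elim (none fzero e)
... | false = countFin-none m (f ∘ fsuc) (none ∘ fsuc)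

countFin-atMostOne : ∀ m (f : Fin m → Bool) → AtMostOne f → countFin m f ≤ 1
countFin-atMostOne zero    f once = z≤n
countFin-atMostOne (suc m) f once with f fzero in e
... | true rewrite countFin-none m (f ∘ fsuc) (λ i fi → 0≢1+n (once fzero (fsuc i) e fi))
  = s≤s z≤n
... | false = countFin-atMostOne m (f ∘ fsuc)
  (λ i j fi fj → suc-injective (once (fsuc i) (fsuc j) fi fj))

-- No three distinct true positions gives count at most 2: if position 0
-- is true, the remaining positions hold at most one further true value.
countFin-noThree : ∀ m (f : Fin m → Bool) → NoThreeDistinct f → countFin m f ≤ 2
countFin-noThree zero    f noThree = z≤n
countFin-noThree (suc m) f noThree with f fzero in e
... | true  = s≤s (countFin-atMostOne m (f ∘ fsuc) restAtMostOne)
  where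
    restAtMostOne : AtMostOne (f ∘ fsuc)
    restAtMostOne i j fi fj with i ≟ j
    ... | yes i≡j = i≡j
    ... | no  i≢j = ⊥-elim (noThree fzero (fsuc i) (fsuc j) (λ ()) (λ ())
                      (i≢j ∘ suc-injective) e fi fj)
... | false = countFin-noThree m (f ∘ fsuc)
  (λ i j k i≢j i≢k j≢k → noThree (fsuc i) (fsuc j) (fsuc k)
     (i≢j ∘ suc-injective) (i≢k ∘ suc-injective) (j≢k ∘ suc-injective))

-- Facts about a single layer ᵍH, for any D whose members have pairwise
-- disjoint open neighbourhoods (the packing half of the EOD condition).
module Layer (G H : Graph) (D : PVtx G H → Bool)
             (disjoint : ∀ u v → D u ≡ true → D v ≡ true → u ≢ v →
                           ∀ x → ¬ (AdjBox G H u x × AdjBox G H v x))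
             (g : Vtx G) where

  layer-≢ : ∀ {h h' : Vtx H} → h ≢ h' → _≢_ {A = PVtx G H} (g , h) (g , h')
  layer-≢ h≢h' eq = h≢h' (cong proj₂ eq)

  -- Two distinct members of D in the layer ᵍH have no common H-neighbour,
  -- since it would lift to a common neighbour in G □ H.
  noCommonNeighbour : ∀ h h' w → h ≢ h' → D (g , h) ≡ true → D (g , h') ≡ true →
    ¬ (Adj H h w × Adj H h' w)
  noCommonNeighbour h h' w h≢h' Dh Dh' (hw , h'w) =
    disjoint (g , h) (g , h') Dh Dh' (layer-≢ h≢h') (g , w)
      (inj₂ (refl , hw) , inj₂ (refl , h'w))

  members-adjacent : (∀ u v → Dist≤2 H u v) →
    ∀ h h' → h ≢ h' → D (g , h) ≡ true → D (g , h') ≡ true → Adj H h h'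
  members-adjacent dist h h' h≢h' Dh Dh' with dist h h'
  ... | inj₁ h≡h'                = ⊥-elim (h≢h' h≡h')
  ... | inj₂ (inj₁ hh')          = hh'
  ... | inj₂ (inj₂ (w , hw , wh')) =
    ⊥-elim (noCommonNeighbour h h' w h≢h' Dh Dh' (hw , trans (Graph.sym H h' w) wh'))

  -- Consequently the layer never contains three distinct members of D:
  -- the third would be a common neighbour of the first two.
  layer-noThree : (∀ u v → Dist≤2 H u v) → NoThreeDistinct (λ h → D (g , h))
  layer-noThree dist i j k i≢j i≢k j≢k Di Dj Dk =
    noCommonNeighbour i j k i≢j Di Dj
      (members-adjacent dist i k i≢k Di Dk , members-adjacent dist j k j≢k Dj Dk)

  -- If D is parallel, the layer contains at most one member of D, since two
  -- distinct ones would be adjacent with equal G-coordinate.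
  layer-atMostOne : (∀ u v → Dist≤2 H u v) → ParallelG G H D →
    AtMostOne (λ h → D (g , h))
  layer-atMostOne dist parallel i j Di Dj with i ≟ j
  ... | yes i≡j = i≡j
  ... | no  i≢j = ⊥-elim (parallel (g , i) (g , j) Di Dj
                    (inj₂ (refl , members-adjacent dist i j i≢j Di Dj)) refl)

mainTheorem5 : (G H : Graph) → Diameter2 H → (D : PVtx G H → Bool) →
    IsEOD (PVtx G H) (AdjBox G H) D →
      (∀ g → layerCount G H D g ≤ 2)
      × (ParallelG G H D → ∀ g → layerCount G H D g ≤ 1)
      × (∀ g → layerCount G H D g ≡ 2 → ∀ h h' → h ≢ h' →
           D (g , h) ≡ true → D (g , h') ≡ true →
           AdjBox G H (g , h) (g , h'))
mainTheorem5 G H (dist , _) D (_ , disjoint) = atMostTwo , parallelAtMostOne , adjacentPair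
  where
    open Layer G H D disjoint

    atMostTwo : ∀ g → layerCount G H D g ≤ 2
    atMostTwo g rewrite layerCount≡countFin G H D g =
      countFin-noThree (n H) _ (layer-noThree g dist)

    parallelAtMostOne : ParallelG G H D → ∀ g → layerCount G H D g ≤ 1
    parallelAtMostOne parallel g rewrite layerCount≡countFin G H D g =
      countFin-atMostOne (n H) _ (layer-atMostOne g dist parallel)

    adjacentPair : ∀ g → layerCount G H D g ≡ 2 → ∀ h h' → h ≢ h' →
      D (g , h) ≡ true → D (g , h') ≡ true → AdjBox G H (g , h) (g , h')
    adjacentPair g _ h h' h≢h' Dh Dh' = inj₂ (refl , members-adjacent g dist h h' h≢h' Dh Dh')
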